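{- Let $(P,\leq)$ be a poset. Then every injective mapping $f\colon P\to P$ satisfying $f([x))=[f(x))$ for all $x\in P$ is upper cone preserving.
   Context: $[x)=\{y\in P\mid x\leq y\}$ is the principal filter generated by $x$. For $A\subseteq P$, $U(A)=\{z\in P\mid y\leq z\text{ for all }y\in A\}$ and $U(x,y)=U(\{x,y\})$. A mapping $f$ is upper cone preserving if $f(U(x,y))=U(f(x),f(y))$ for all $x,y\in P$. -}

module Defs where

open import Level using (Level; _⊔_)
open import Data.Product using (Σ; _×_; _,_)
open import Relation.Binary.PropositionalEquality using (_≡_)
open import Relation.Binary.Structures using (IsPartialOrder)

module _ {a ℓ : Level} {P : Set a} (_≤_ : P → P → Set ℓ) where

  [_⟩ : P → P → Set ℓ
  [ x ⟩ y = x ≤ y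

  U : P → P → P → Set ℓ
  U x y z = (x ≤ z) × (y ≤ z)

image : {a ℓ : Level} {P : Set a} → (P → P) → (P → Set ℓ) → P → Set (a ⊔ ℓ)
image {P = P} f A y = Σ P (λ x → A x × (f x ≡ y))

_≐_ : {a ℓ m : Level} {P : Set a} → (P → Set ℓ) → (P → Set m) → Set (a ⊔ ℓ ⊔ m)
_≐_ {P = P} A B = ((y : P) → A y → B y) × ((y : P) → B y → A y)

Injective : {a : Level} {P : Set a} → (P → P) → Set a
Injective {P = P} f = (x y : P) → f x ≡ f y → x ≡ y

UpperConePreserving : {a ℓ : Level} {P : Set a} → (P → P → Set ℓ) → (P → P) → Set (a ⊔ ℓ)
UpperConePreserving {P = P} _≤_ f =
  (x y : P) → image f (U _≤_ x y) ≐ U _≤_ (f x) (f y)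

{-# OPTIONS --safe #-}
module Submission where

open import Defs
open import Level using (Level)
open import Relation.Binary.PropositionalEquality using (_≡_; refl; trans; sym; subst)
open import Relation.Binary.Structures using (IsPartialOrder)
open import Data.Product using (_,_; proj₁; proj₂)

-- Only injectivity and the filter condition matter: the argument works for an
-- arbitrary relation.

module _ {a ℓ : Level} {P : Set a} (_≤_ : P → P → Set ℓ) (f : P → P) where

  image-U⊆U-image : (∀ x → (y : P) → image f ([_⟩ _≤_ x) y → [_⟩ _≤_ (f x) y)
    → ∀ x y w → image f (U _≤_ x y) w → U _≤_ (f x) (f y) w
  image-U⊆U-image image-filter⊆filter x y .(f z) (z , (x≤z , y≤z) , refl) =
    image-filter⊆filter x (f z) (z , x≤z , refl) ,
    image-filter⊆filter y (f z) (z , y≤z , refl)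

  -- Both filters of x and y provide a preimage of w; injectivity makes them equal.
  U-image⊆image-U : Injective f
    → (∀ x → (y : P) → [_⟩ _≤_ (f x) y → image f ([_⟩ _≤_ x) y)
    → ∀ x y w → U _≤_ (f x) (f y) w → image f (U _≤_ x y) w
  U-image⊆image-U inj filter⊆image-filter x y w (fx≤w , fy≤w)
    with filter⊆image-filter x w fx≤w | filter⊆image-filter y w fy≤w
  ... | z , x≤z , fz≡w | z′ , y≤z′ , fz′≡w =
    z , (x≤z , subst (y ≤_) (inj z′ z (trans fz′≡w (sym fz≡w))) y≤z′) , fz≡w

proposition2p5 : {a ℓ : Level} (P : Set a) (_≤_ : P → P → Set ℓ)
    → IsPartialOrder _≡_ _≤_
    → (f : P → P) → Injective f
    → ((x : P) → image f ([_⟩ _≤_ x) ≐ [_⟩ _≤_ (f x))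
    → UpperConePreserving _≤_ f
proposition2p5 P _≤_ _ f inj filter-preserved x y =
  image-U⊆U-image _≤_ f (λ x → proj₁ (filter-preserved x)) x y ,
  U-image⊆image-U _≤_ f inj (λ x → proj₂ (filter-preserved x)) x y
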